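{- For any graphs $G$ and $H$ of orders $n\ge 2$ and $n'\ge 2$, respectively, $$\left\lceil\frac{nn'}{2}\right\rceil\le \gamma_{\rm sp}(G\Box H)\le n'\gamma_{\rm sp}(G)-\lambda(G)\bigl(n'-\gamma_{\rm sp}(H)\bigr).$$
   Context: All graphs are finite, simple and undirected. For a vertex $v$, $N(v)$ is its set of neighbours, and for $X\subseteq V(G)$, $N(X)=\bigcup_{x\in X}N(x)$; for $D\subseteq V(G)$, $\overline{D}=V(G)\setminus D$. A set $D\subseteq V(G)$ is a super dominating set of $G$ if for every $u\in\overline{D}$ there exists $v\in D$ such that $N(v)\cap\overline{D}=\{u\}$; the super domination number $\gamma_{\rm sp}(G)$ is the minimum cardinality of a super dominating set, and a super dominating set of that cardinality is a $\gamma_{\rm sp}(G)$-set. Let $\mathcal{S}(G)$ be the set of all $\gamma_{\rm sp}(G)$-sets. For $S\in\mathcal{S}(G)$, $\mathcal{P}(S)$ is the family of subsets $S^*\subseteq S$ with $|S^*|=|\overline{S}|$ such that for every $u\in\overline{S}$ there is $u^*\in S^*$ with $N(u^*)\cap\overline{S}=\{u\}$. Define $$\lambda(G)=\max_{S\in\mathcal{S}(G),\,S^*\in\mathcal{P}(S)}\{|X|:\ X\subseteq S\text{ and }N(X)\cap(\overline{S}\cup S^*)=\emptyset\}.$$ The Cartesian product $G\Box H$ has vertex set $V(G)\times V(H)$, with $(g,h)$ adjacent to $(g',h')$ iff either $g=g'$ and $hh'\in E(H)$, or $gg'\in E(G)$ and $h=h'$. -}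

module Defs where

open import Data.Nat using (ℕ; _*_; _≤_)
open import Data.Fin using (Fin; remQuot)
open import Data.Fin.Subset using (Subset; _∈_; _∉_; _⊆_; ∁; ∣_∣)
open import Data.Product using (Σ; ∃; ∃-syntax; _×_; _,_; proj₁; proj₂)
open import Data.Sum using (_⊎_; inj₁; inj₂)
open import Relation.Nullary using (¬_)
open import Relation.Binary.PropositionalEquality using (_≡_; sym)

record Graph (n : ℕ) : Set₁ where
  field
    Adj    : Fin n → Fin n → Set
    symm   : ∀ {i j} → Adj i j → Adj j i
    irrefl : ∀ {i} → ¬ Adj i i
open Graph public

module _ {n : ℕ} (G : Graph n) where

  PrivateNbr : Subset n → Fin n → Fin n → Set
  PrivateNbr D v u =
    (u ∉ D × Adj G v u) × (∀ w → w ∉ D → Adj G v w → w ≡ u)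

  SuperDominating : Subset n → Set
  SuperDominating D = ∀ u → u ∉ D → ∃[ v ] (v ∈ D × PrivateNbr D v u)

  IsSuperDominationNumber : ℕ → Set
  IsSuperDominationNumber k =
    (∃[ D ] (SuperDominating D × ∣ D ∣ ≡ k))
    × (∀ D → SuperDominating D → k ≤ ∣ D ∣)

  IsGammaSpSet : Subset n → Set
  IsGammaSpSet S = SuperDominating S × (∀ D → SuperDominating D → ∣ S ∣ ≤ ∣ D ∣)

  InP : Subset n → Subset n → Set
  InP S S* =
    S* ⊆ S × ∣ S* ∣ ≡ ∣ ∁ S ∣
    × (∀ u → u ∉ S → ∃[ u* ] (u* ∈ S* × PrivateNbr S u* u))

  Admissible : Subset n → Subset n → Subset n → Set
  Admissible S S* X =
    X ⊆ S × (∀ x y → x ∈ X → Adj G x y → (y ∈ S × y ∉ S*))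

  IsLambda : ℕ → Set
  IsLambda l =
    (∃[ S ] ∃[ S* ] ∃[ X ]
       (IsGammaSpSet S × InP S S* × Admissible S S* X × ∣ X ∣ ≡ l))
    × (∀ S S* X → IsGammaSpSet S → InP S S* → Admissible S S* X → ∣ X ∣ ≤ l)

-- Cartesian product G □ H on Fin (n * n'), vertex i ↔ remQuot n' i = (g , h).
_□_ : ∀ {n n'} → Graph n → Graph n' → Graph (n * n')
_□_ {n} {n'} G H = record
  { Adj = λ i j → A (remQuot n' i) (remQuot n' j)
  ; symm = λ {i} {j} → sy (remQuot n' i) (remQuot n' j)
  ; irrefl = λ {i} → ir (remQuot n' i)
  }
  where
  A : Fin n × Fin n' → Fin n × Fin n' → Set
  A (g , h) (g' , h') = (g ≡ g' × Adj H h h') ⊎ (Adj G g g' × h ≡ h')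
  sy : ∀ p q → A p q → A q p
  sy _ _ (inj₁ (e , a)) = inj₁ (sym e , symm H a)
  sy _ _ (inj₂ (a , e)) = inj₂ (symm G a , sym e)
  ir : ∀ p → ¬ A p p
  ir _ (inj₁ (_ , a)) = irrefl H a
  ir _ (inj₂ (a , _)) = irrefl G a

-- Lower bound: a super dominating set D injects its complement into itself (each outside vertex to a
-- private neighbour, which determines it), so |V| ≤ 2|D|.
-- Upper bound: take a γ_sp(G)-set S with S* ∈ 𝒫(S), an admissible X attaining λ(G) and a γ_sp(H)-set T,
-- and put (g, h) in D when g ∈ S ∖ X, or g ∈ X and h ∈ T; this has n'|S| − |X|(n' − |T|) vertices.
-- A vertex (g, h) ∉ D with g ∉ S is privately dominated by (g*, h), where g* ∈ S* is the private
-- neighbour of g; one with g ∈ S has g ∈ X and h ∉ T, and is privately dominated by (g, h*), where h*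
-- is the private neighbour of h for T. Admissibility of X rules out every competing neighbour.
module Submission where

open import Data.Nat using (ℕ; suc; _*_; _+_; _∸_; _≤_; ⌈_/2⌉)
open import Data.Nat.Properties
  using (≤-antisym; ≤-trans; ≤-reflexive; +-monoʳ-≤; +-assoc; +-commutativeSemigroup;
         m≤n+m∸n; m+n∸n≡m; m+[n∸m]≡n; *-comm; ⌈n/2⌉-mono; n≡⌈n+n/2⌉)
open import Algebra.Properties.CommutativeSemigroup +-commutativeSemigroup using (interchange)
open import Data.Fin using (Fin; zero; suc; combine; remQuot)
open import Data.Fin.Properties using (injective⇒≤; suc-injective; remQuot-combine; combine-remQuot)
open import Data.Fin.Subset using (Subset; Side; inside; outside; _∈_; _∉_; _⊆_; ∁; ⊤; ⊥; ∣_∣)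
open import Data.Fin.Subset.Properties
  using (_∈?_; ∈⊤; ∣⊤∣≡n; ∣⊥∣≡0; ∣p∣≤n; ∣∁p∣≡n∸∣p∣; x∈∁p⇒x∉p; drop-∷-⊆)
open import Data.Vec using ([]; _∷_; _++_; concat; zipWith; lookup; here; there)
open import Data.Vec.Properties using (lookup-concat; lookup-zipWith; []=⇒lookup; lookup⇒[]=)
open import Data.Product using (∃-syntax; _×_; _,_; proj₁; proj₂; uncurry)
open import Data.Sum using (_⊎_; inj₁; inj₂)
open import Function.Definitions using (Injective)
open import Relation.Binary.PropositionalEquality
open import Relation.Nullary using (yes; no; contradiction)

open import Defs

∣p++q∣≡∣p∣+∣q∣ : ∀ {m k} (p : Subset m) (q : Subset k) → ∣ p ++ q ∣ ≡ ∣ p ∣ + ∣ q ∣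
∣p++q∣≡∣p∣+∣q∣ []            q = refl
∣p++q∣≡∣p∣+∣q∣ (inside  ∷ p) q = cong suc (∣p++q∣≡∣p∣+∣q∣ p q)
∣p++q∣≡∣p∣+∣q∣ (outside ∷ p) q = ∣p++q∣≡∣p∣+∣q∣ p q

x∉p⇒lookup≡outside : ∀ {m} {p : Subset m} {x} → x ∉ p → lookup p x ≡ outside
x∉p⇒lookup≡outside {p = p} {x} x∉p with lookup p x in eq
... | inside  = contradiction (lookup⇒[]= x p eq) x∉p
... | outside = refl

enumerate : ∀ {m} (p : Subset m) → Fin ∣ p ∣ → Fin m
enumerate (inside  ∷ p) zero    = zero
enumerate (inside  ∷ p) (suc i) = suc (enumerate p i)
enumerate (outside ∷ p) i       = suc (enumerate p i)

enumerate-∈ : ∀ {m} (p : Subset m) i → enumerate p i ∈ p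
enumerate-∈ (inside  ∷ p) zero    = here
enumerate-∈ (inside  ∷ p) (suc i) = there (enumerate-∈ p i)
enumerate-∈ (outside ∷ p) i       = there (enumerate-∈ p i)

enumerate-injective : ∀ {m} (p : Subset m) → Injective _≡_ _≡_ (enumerate p)
enumerate-injective (inside  ∷ p) {zero}  {zero}  _  = refl
enumerate-injective (inside  ∷ p) {zero}  {suc _} ()
enumerate-injective (inside  ∷ p) {suc _} {zero}  ()
enumerate-injective (inside  ∷ p) {suc _} {suc _} eq =
  cong suc (enumerate-injective p (suc-injective eq))
enumerate-injective (outside ∷ p) eq = enumerate-injective p (suc-injective eq)

index : ∀ {m} {p : Subset m} {x} → x ∈ p → Fin ∣ p ∣
index {p = inside  ∷ _} here        = zero
index {p = inside  ∷ _} (there x∈p) = suc (index x∈p)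
index {p = outside ∷ _} (there x∈p) = index x∈p

index-injective : ∀ {m} {p : Subset m} {x y} (x∈p : x ∈ p) (y∈p : y ∈ p) →
                  index x∈p ≡ index y∈p → x ≡ y
index-injective                   here        here        _  = refl
index-injective {p = inside  ∷ _} (there x∈p) (there y∈p) eq =
  cong suc (index-injective x∈p y∈p (suc-injective eq))
index-injective {p = outside ∷ _} (there x∈p) (there y∈p) eq =
  cong suc (index-injective x∈p y∈p eq)

injective⇒∣p∣≤∣q∣ : ∀ {m k} {p : Subset m} {q : Subset k}
  (f : ∀ {x} → x ∈ p → Fin k) → (∀ {x} (x∈p : x ∈ p) → f x∈p ∈ q) →
  (∀ {x y} (x∈p : x ∈ p) (y∈p : y ∈ p) → f x∈p ≡ f y∈p → x ≡ y) →
  ∣ p ∣ ≤ ∣ q ∣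
injective⇒∣p∣≤∣q∣ {p = p} f f∈q f-injective = injective⇒≤ {f = position} position-injective
  where
  position : Fin ∣ p ∣ → Fin _
  position i = index (f∈q (enumerate-∈ p i))
  position-injective : Injective _≡_ _≡_ position
  position-injective {i} {j} eq = enumerate-injective p
    (f-injective (enumerate-∈ p i) (enumerate-∈ p j) (index-injective (f∈q _) (f∈q _) eq))

module _ {n} (G : Graph n) where

  privateNbr-unique : ∀ {D v u u'} → PrivateNbr G D v u → PrivateNbr G D v u' → u ≡ u'
  privateNbr-unique ((u∉D , vu) , _) (_ , only-u') = only-u' _ u∉D vu

  ∣∁D∣≤∣D∣ : ∀ {D} → SuperDominating G D → ∣ ∁ D ∣ ≤ ∣ D ∣
  ∣∁D∣≤∣D∣ {D} D-sd = injective⇒∣p∣≤∣q∣ (λ u∈∁D → proj₁ (dominator u∈∁D)) (λ u∈∁D → proj₁ (proj₂ (dominator u∈∁D)))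
    λ u∈∁D u'∈∁D eq → privateNbr-unique (proj₂ (proj₂ (dominator u∈∁D)))
      (subst (λ v → PrivateNbr G D v _) (sym eq) (proj₂ (proj₂ (dominator u'∈∁D))))
    where
    dominator : ∀ {u} → u ∈ ∁ D → ∃[ v ] (v ∈ D × PrivateNbr G D v u)
    dominator {u} u∈∁D = D-sd u (x∈∁p⇒x∉p u∈∁D)

  ⌈n/2⌉≤∣D∣ : ∀ {D} → SuperDominating G D → ⌈ n /2⌉ ≤ ∣ D ∣
  ⌈n/2⌉≤∣D∣ {D} D-sd = ≤-trans (⌈n/2⌉-mono n≤2∣D∣) (≤-reflexive (sym (n≡⌈n+n/2⌉ ∣ D ∣)))
    where
    n≤2∣D∣ : n ≤ ∣ D ∣ + ∣ D ∣
    n≤2∣D∣ = ≤-trans (m≤n+m∸n n ∣ D ∣)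
      (+-monoʳ-≤ ∣ D ∣ (subst (_≤ ∣ D ∣) (∣∁p∣≡n∸∣p∣ D) (∣∁D∣≤∣D∣ D-sd)))

  ∣γsp-set∣≡γsp : ∀ {S k} → IsGammaSpSet G S → IsSuperDominationNumber G k → ∣ S ∣ ≡ k
  ∣γsp-set∣≡γsp (S-sd , S-min) ((D , D-sd , refl) , k-min) = ≤-antisym (S-min D D-sd) (k-min _ S-sd)

module _ {n'} (T : Subset n') where

  fibre : Side → Side → Subset n'
  fibre outside _       = ⊥
  fibre inside  outside = ⊤
  fibre inside  inside  = T

  -- Laid out in the vertex order of G □ H, where (g , h) is combine g h.
  fibres : ∀ {m} → Subset m → Subset m → Subset (m * n')
  fibres S X = concat (zipWith fibre S X)

  T⊆fibre-inside : ∀ x → T ⊆ fibre inside x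
  T⊆fibre-inside outside _   = ∈⊤
  T⊆fibre-inside inside  h∈T = h∈T

  module _ {m} {S X : Subset m} {g : Fin m} {h : Fin n'} where

    fibre-∈⇒∈-fibres : h ∈ fibre (lookup S g) (lookup X g) → combine g h ∈ fibres S X
    fibre-∈⇒∈-fibres h∈fibre = lookup⇒[]= (combine g h) (fibres S X) (begin
      lookup (fibres S X) (combine g h)          ≡⟨ lookup-concat (zipWith fibre S X) g h ⟩
      lookup (lookup (zipWith fibre S X) g) h    ≡⟨ cong (λ r → lookup r h) (lookup-zipWith fibre g S X) ⟩
      lookup (fibre (lookup S g) (lookup X g)) h ≡⟨ []=⇒lookup h∈fibre ⟩
      inside                                     ∎)
      where open ≡-Reasoning

    ∈-fibres-full : g ∈ S → g ∉ X → combine g h ∈ fibres S X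
    ∈-fibres-full g∈S g∉X = fibre-∈⇒∈-fibres
      (subst₂ (λ s x → h ∈ fibre s x) (sym ([]=⇒lookup g∈S)) (sym (x∉p⇒lookup≡outside g∉X)) ∈⊤)

    ∈-fibres-T : g ∈ S → h ∈ T → combine g h ∈ fibres S X
    ∈-fibres-T g∈S h∈T = fibre-∈⇒∈-fibres
      (subst (λ s → h ∈ fibre s (lookup X g)) (sym ([]=⇒lookup g∈S)) (T⊆fibre-inside (lookup X g) h∈T))

    ∉-fibres⇒∈X : g ∈ S → combine g h ∉ fibres S X → g ∈ X
    ∉-fibres⇒∈X g∈S ∉fibres with g ∈? X
    ... | yes g∈X = g∈X
    ... | no  g∉X = contradiction (∈-fibres-full g∈S g∉X) ∉fibres

  ∣fibres∣+∣X∣*∣∁T∣≡∣S∣*n' : ∀ {m} (S X : Subset m) → X ⊆ S →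
    ∣ fibres S X ∣ + ∣ X ∣ * (n' ∸ ∣ T ∣) ≡ ∣ S ∣ * n'
  ∣fibres∣+∣X∣*∣∁T∣≡∣S∣*n' [] [] _ = refl
  ∣fibres∣+∣X∣*∣∁T∣≡∣S∣*n' (outside ∷ S) (outside ∷ X) X⊆S = begin
    ∣ ⊥ {n'} ++ fibres S X ∣ + ∣ X ∣ * c   ≡⟨ cong (_+ ∣ X ∣ * c) (∣p++q∣≡∣p∣+∣q∣ (⊥ {n'}) (fibres S X)) ⟩
    ∣ ⊥ {n'} ∣ + ∣ fibres S X ∣ + ∣ X ∣ * c ≡⟨ cong (λ k → k + ∣ fibres S X ∣ + ∣ X ∣ * c) (∣⊥∣≡0 n') ⟩
    ∣ fibres S X ∣ + ∣ X ∣ * c         ≡⟨ ∣fibres∣+∣X∣*∣∁T∣≡∣S∣*n' S X (drop-∷-⊆ X⊆S) ⟩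
    ∣ S ∣ * n'                         ∎
    where open ≡-Reasoning; c = n' ∸ ∣ T ∣
  ∣fibres∣+∣X∣*∣∁T∣≡∣S∣*n' (inside ∷ S) (outside ∷ X) X⊆S = begin
    ∣ ⊤ {n'} ++ fibres S X ∣ + ∣ X ∣ * c        ≡⟨ cong (_+ ∣ X ∣ * c) (∣p++q∣≡∣p∣+∣q∣ (⊤ {n'}) (fibres S X)) ⟩
    ∣ ⊤ {n'} ∣ + ∣ fibres S X ∣ + ∣ X ∣ * c ≡⟨ cong (λ k → k + ∣ fibres S X ∣ + ∣ X ∣ * c) (∣⊤∣≡n n') ⟩
    n' + ∣ fibres S X ∣ + ∣ X ∣ * c         ≡⟨ +-assoc n' _ _ ⟩
    n' + (∣ fibres S X ∣ + ∣ X ∣ * c)       ≡⟨ cong (n' +_) (∣fibres∣+∣X∣*∣∁T∣≡∣S∣*n' S X (drop-∷-⊆ X⊆S)) ⟩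
    n' + ∣ S ∣ * n'                         ∎
    where open ≡-Reasoning; c = n' ∸ ∣ T ∣
  ∣fibres∣+∣X∣*∣∁T∣≡∣S∣*n' (inside ∷ S) (inside ∷ X) X⊆S = begin
    ∣ T ++ fibres S X ∣ + (c + ∣ X ∣ * c)     ≡⟨ cong (_+ (c + ∣ X ∣ * c)) (∣p++q∣≡∣p∣+∣q∣ T (fibres S X)) ⟩
    ∣ T ∣ + ∣ fibres S X ∣ + (c + ∣ X ∣ * c)   ≡⟨ interchange ∣ T ∣ _ c _ ⟩
    ∣ T ∣ + c + (∣ fibres S X ∣ + ∣ X ∣ * c)   ≡⟨ cong₂ _+_ (m+[n∸m]≡n (∣p∣≤n T))
                                                   (∣fibres∣+∣X∣*∣∁T∣≡∣S∣*n' S X (drop-∷-⊆ X⊆S)) ⟩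
    n' + ∣ S ∣ * n'                            ∎
    where open ≡-Reasoning; c = n' ∸ ∣ T ∣
  ∣fibres∣+∣X∣*∣∁T∣≡∣S∣*n' (outside ∷ S) (inside ∷ X) X⊆S = contradiction (X⊆S here) λ ()

  ∣fibres∣≡n'*∣S∣∸∣X∣*∣∁T∣ : ∀ {m} {S X : Subset m} → X ⊆ S → ∣ fibres S X ∣ ≡ n' * ∣ S ∣ ∸ ∣ X ∣ * (n' ∸ ∣ T ∣)
  ∣fibres∣≡n'*∣S∣∸∣X∣*∣∁T∣ {S = S} {X} X⊆S = begin
    ∣ fibres S X ∣                               ≡⟨ m+n∸n≡m ∣ fibres S X ∣ c ⟨
    ∣ fibres S X ∣ + c ∸ c                       ≡⟨ cong (_∸ c) (∣fibres∣+∣X∣*∣∁T∣≡∣S∣*n' S X X⊆S) ⟩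
    ∣ S ∣ * n' ∸ c                               ≡⟨ cong (_∸ c) (*-comm ∣ S ∣ n') ⟩
    n' * ∣ S ∣ ∸ c                               ∎
    where open ≡-Reasoning; c = ∣ X ∣ * (n' ∸ ∣ T ∣)

module _ {n n'} (G : Graph n) (H : Graph n') where

  -- Adjacency of G □ H in coordinates: Adj (G □ H) i j is definitionally remQuot n' i ∼ remQuot n' j.
  _∼_ : Fin n × Fin n' → Fin n × Fin n' → Set
  (g , h) ∼ (g' , h') = (g ≡ g' × Adj H h h') ⊎ (Adj G g g' × h ≡ h')

  ⟨_⟩ : Fin n × Fin n' → Fin (n * n')
  ⟨_⟩ = uncurry combine

  PrivateNbr□ : Subset (n * n') → Fin n × Fin n' → Fin n × Fin n' → Set
  PrivateNbr□ D q p = q ∼ p × (∀ r → ⟨ r ⟩ ∉ D → q ∼ r → r ≡ p)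

  superDominating-□ : ∀ D → (∀ p → ⟨ p ⟩ ∉ D → ∃[ q ] (⟨ q ⟩ ∈ D × PrivateNbr□ D q p)) →
                      SuperDominating (G □ H) D
  superDominating-□ D dominate u u∉D
    with dominate (remQuot n' u) (subst (_∉ D) (sym (combine-remQuot {n} n' u)) u∉D)
  ... | q , q∈D , q∼p , only-p = ⟨ q ⟩ , q∈D , (u∉D , subst (_∼ remQuot n' u) (sym q-coords) q∼p) , only-u
    where
    q-coords : remQuot n' ⟨ q ⟩ ≡ q
    q-coords = remQuot-combine (proj₁ q) (proj₂ q)
    only-u : ∀ w → w ∉ D → Adj (G □ H) ⟨ q ⟩ w → w ≡ u
    only-u w w∉D q∼w = begin
      w                        ≡⟨ combine-remQuot {n} n' w ⟨
      ⟨ remQuot n' w ⟩         ≡⟨ cong ⟨_⟩ (only-p (remQuot n' w)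
                                    (subst (_∉ D) (sym (combine-remQuot {n} n' w)) w∉D)
                                    (subst (_∼ remQuot n' w) q-coords q∼w)) ⟩
      ⟨ remQuot n' u ⟩         ≡⟨ combine-remQuot {n} n' u ⟩
      u                        ∎
      where open ≡-Reasoning

  module _ {S S* X : Subset n} {T : Subset n'} (S*∈𝒫S : InP G S S*)
           (X-admissible : Admissible G S S* X) (T-sd : SuperDominating H T) where

    private
      D : Subset (n * n')
      D = fibres T S X

    dominated-along-G : ∀ {g} h → g ∉ S → ∃[ q ] (⟨ q ⟩ ∈ D × PrivateNbr□ D q (g , h))
    dominated-along-G {g} h g∉S with proj₂ (proj₂ S*∈𝒫S) g g∉S
    ... | g* , g*∈S* , (_ , g*g) , g*-private =
      (g* , h) , ∈-fibres-full T g*∈S g*∉X , inj₂ (g*g , refl) , only-gh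
      where
      g*∈S : g* ∈ S
      g*∈S = proj₁ S*∈𝒫S g*∈S*
      g*∉X : g* ∉ X
      g*∉X g*∈X = g∉S (proj₁ (proj₂ X-admissible g* g g*∈X g*g))
      only-gh : ∀ r → ⟨ r ⟩ ∉ D → (g* , h) ∼ r → r ≡ (g , h)
      only-gh (_ , _) r∉D (inj₁ (refl , _)) = contradiction (∈-fibres-full T g*∈S g*∉X) r∉D
      only-gh (g' , _) r∉D (inj₂ (g*g' , refl)) with g' ∈? S
      ... | no  g'∉S = cong (_, h) (g*-private g' g'∉S g*g')
      ... | yes g'∈S = contradiction g*∈S*
        (proj₂ (proj₂ X-admissible g' g* (∉-fibres⇒∈X T g'∈S r∉D) (symm G g*g')))

    dominated-along-H : ∀ {g h} → g ∈ X → h ∉ T → ∃[ q ] (⟨ q ⟩ ∈ D × PrivateNbr□ D q (g , h))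
    dominated-along-H {g} {h} g∈X h∉T with T-sd h h∉T
    ... | h* , h*∈T , (_ , h*h) , h*-private =
      (g , h*) , ∈-fibres-T T g∈S h*∈T , inj₁ (refl , h*h) , only-gh
      where
      g∈S : g ∈ S
      g∈S = proj₁ X-admissible g∈X
      only-gh : ∀ r → ⟨ r ⟩ ∉ D → (g , h*) ∼ r → r ≡ (g , h)
      only-gh (_ , h') r∉D (inj₁ (refl , h*h')) =
        cong (g ,_) (h*-private h' (λ h'∈T → r∉D (∈-fibres-T T g∈S h'∈T)) h*h')
      only-gh (g' , _) r∉D (inj₂ (gg' , refl)) =
        contradiction (∈-fibres-T T (proj₁ (proj₂ X-admissible g g' g∈X gg')) h*∈T) r∉D

    fibres-superDominating : SuperDominating (G □ H) D
    fibres-superDominating = superDominating-□ D dominated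
      where
      dominated : ∀ p → ⟨ p ⟩ ∉ D → ∃[ q ] (⟨ q ⟩ ∈ D × PrivateNbr□ D q p)
      dominated (g , h) p∉D with g ∈? S
      ... | no  g∉S = dominated-along-G h g∉S
      ... | yes g∈S = dominated-along-H (∉-fibres⇒∈X T g∈S p∉D) (λ h∈T → p∉D (∈-fibres-T T g∈S h∈T))

theorem20 : ∀ {n n'} (G : Graph n) (H : Graph n') → 2 ≤ n → 2 ≤ n' →
    ∀ (γG γH γGH l : ℕ) →
    IsSuperDominationNumber G γG → IsSuperDominationNumber H γH →
    IsSuperDominationNumber (G □ H) γGH → IsLambda G l →
    ⌈ (n * n') /2⌉ ≤ γGH × γGH ≤ n' * γG ∸ l * (n' ∸ γH)
theorem20 G H _ _ γG _ _ _ γG-number ((T , T-sd , refl) , _) ((D , D-sd , refl) , D-min)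
  ((S , S* , X , S-γsp , S*∈𝒫S , X-admissible , refl) , _)
  with refl ← ∣γsp-set∣≡γsp G S-γsp γG-number
  = ⌈n/2⌉≤∣D∣ (G □ H) D-sd
  , ≤-trans (D-min (fibres T S X) (fibres-superDominating G H S*∈𝒫S X-admissible T-sd))
            (≤-reflexive (∣fibres∣≡n'*∣S∣∸∣X∣*∣∁T∣ T (proj₁ X-admissible)))
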